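{- There exist infinitely many positive odd integers $n$ with the property that there exist positive integers $d_1, d_2$, both dividing $\frac{n^2+1}{2}$, such that $d_1+d_2=2n$. Moreover, any such positive odd integer $n$ and positive divisors $d_1,d_2$ of $\frac{n^2+1}{2}$ with $d_1+d_2=2n$ satisfy $\gcd(d_1,d_2)=1$ and $d_1d_2=\frac{n^2+1}{2}$. -}

module Defs where

open import Data.Nat using (ℕ; _+_; _*_; _<_)
open import Data.Nat.DivMod using (_/_)
open import Data.Nat.Divisibility using (_∣_)
open import Data.Product using (_×_; ∃-syntax)
open import Relation.Binary.PropositionalEquality using (_≡_)
open import Relation.Nullary using (¬_)

PosOdd : ℕ → Set
PosOdd n = 0 < n × ¬ (2 ∣ n)

-- (n^2 + 1) / 2 ; for odd n this division is exact
half : ℕ → ℕ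
half n = (n * n + 1) / 2

GoodPair : ℕ → ℕ → ℕ → Set
GoodPair n d₁ d₂ = 0 < d₁ × 0 < d₂ × d₁ ∣ half n × d₂ ∣ half n × d₁ + d₂ ≡ 2 * n

Good : ℕ → Set
Good n = PosOdd n × ∃[ d₁ ] ∃[ d₂ ] GoodPair n d₁ d₂

{-# OPTIONS --safe #-}
-- If d₁, d₂ ∣ (n² + 1)/2 and d₁ + d₂ = 2n, then gcd d₁ d₂ divides 2 and an odd
-- number, so it is 1 and (n² + 1)/2 = r d₁ d₂.  Since (d₁ + d₂)² + 4 = 8r d₁ d₂,
-- the pair (d₁, d₂) solves x² + y² + 4 = (8r − 2) x y, and Vieta jumping shows
-- that this equation has no positive solutions once 8r − 2 ≥ 11, forcing r = 1.
-- Conversely, for every solution of the Pell equation n² − 8v² = 1 the numbers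
-- n − 2v and n + 2v are such divisors, and there are infinitely many solutions.
module Submission where

open import Defs
open import Data.List using ([]; _∷_)
open import Data.Nat
open import Data.Nat.Properties
open import Data.Nat.Divisibility
open import Data.Nat.DivMod using (_/_; _%_; m≡m%n+[m/n]*n; m%n<n; m*n/n≡m)
open import Data.Nat.GCD using (gcd; gcd[m,n]∣m; gcd[m,n]∣n)
open import Data.Nat.LCM using (lcm; lcm-least; gcd*lcm)
open import Data.Nat.Primality using (irreducible[2])
open import Data.Nat.Tactic.RingSolver using (solve)
open import Data.Product using (_×_; _,_; ∃-syntax)
open import Data.Sum using (inj₁; inj₂; [_,_]′; fromInj₁)
open import Function using (_∘′_)
open import Relation.Nullary using (¬_; yes; no; contradiction)
open import Relation.Binary.PropositionalEquality

private
  variable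
    k n M x y d₁ d₂ : ℕ

VietaEq : ℕ → ℕ → ℕ → Set
VietaEq k x y = x * x + y * y + 4 ≡ k * x * y

VietaEq-sym : VietaEq k x y → VietaEq k y x
VietaEq-sym {k} {x} {y} e = begin
  y * y + x * x + 4 ≡⟨ solve (x ∷ y ∷ []) ⟩
  x * x + y * y + 4 ≡⟨ e ⟩
  k * x * y         ≡⟨ solve (k ∷ x ∷ y ∷ []) ⟩
  k * y * x         ∎
  where open ≡-Reasoning

VietaEq⇒∣ : VietaEq k x y → y ∣ x * x + 4
VietaEq⇒∣ {k} {x} {y} e = ∣m+n∣m⇒∣n (subst (y ∣_) k*x*y≡ (n∣m*n (k * x))) (m∣m*n y)
  where
  k*x*y≡ : k * x * y ≡ y * y + (x * x + 4)
  k*x*y≡ = trans (sym e) (solve (x ∷ y ∷ []))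

-- The other root q = k x − y of  t² − k x t + x² + 4  is (x² + 4)/y.
VietaEq-jump : ∀ {k x y q} → .{{NonZero y}} → VietaEq k x y → x * x + 4 ≡ q * y → VietaEq k x q
VietaEq-jump {k} {x} {y} {q} e x²+4≡qy = begin
  x * x + q * q + 4   ≡⟨ solve (x ∷ q ∷ []) ⟩
  (x * x + 4) + q * q ≡⟨ cong (_+ q * q) x²+4≡qy ⟩
  q * y + q * q       ≡⟨ solve (q ∷ y ∷ []) ⟩
  q * (y + q)         ≡⟨ cong (q *_) y+q≡kx ⟩
  q * (k * x)         ≡⟨ solve (k ∷ x ∷ q ∷ []) ⟩
  k * x * q           ∎
  where
  open ≡-Reasoning
  y+q≡kx : y + q ≡ k * x
  y+q≡kx = *-cancelʳ-≡ (y + q) (k * x) y (begin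
    (y + q) * y         ≡⟨ solve (y ∷ q ∷ []) ⟩
    y * y + q * y       ≡⟨ cong (y * y +_) x²+4≡qy ⟨
    y * y + (x * x + 4) ≡⟨ solve (x ∷ y ∷ []) ⟩
    x * x + y * y + 4   ≡⟨ e ⟩
    k * x * y           ∎)

¬VietaEq-minimal : 11 ≤ k → 0 < x → x ≤ y → y * y ≤ x * x + 4 → ¬ VietaEq k x y
¬VietaEq-minimal {k} {x} {y} 11≤k 0<x x≤y y²≤x²+4 e = <-irrefl refl (begin-strict
  2 * (x * x) + 8             <⟨ +-monoʳ-< (2 * (x * x)) (*-monoʳ-≤ 9 (*-mono-≤ 0<x 0<x)) ⟩
  2 * (x * x) + 9 * (x * x)   ≡⟨ solve (x ∷ []) ⟩
  11 * (x * x)                ≤⟨ *-monoˡ-≤ (x * x) 11≤k ⟩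
  k * (x * x)                 ≡⟨ solve (k ∷ x ∷ []) ⟩
  k * x * x                   ≤⟨ *-monoʳ-≤ (k * x) x≤y ⟩
  k * x * y                   ≡⟨ e ⟨
  x * x + y * y + 4           ≤⟨ +-monoˡ-≤ 4 (+-monoʳ-≤ (x * x) y²≤x²+4) ⟩
  x * x + (x * x + 4) + 4     ≡⟨ solve (x ∷ []) ⟩
  2 * (x * x) + 8             ∎)
  where open ≤-Reasoning

-- Vieta jumping: unless y is already the smaller root, jumping to (x, q) decreases x + y ≤ s.
¬VietaEq-descent : ∀ s → 11 ≤ k → x ≤ y → x + y ≤ s → 0 < x → 0 < y → ¬ VietaEq k x y
¬VietaEq-descent zero 11≤k x≤y x+y≤0 0<x 0<y e =
  <-irrefl refl (≤-trans 0<x (≤-trans (m≤m+n _ _) x+y≤0))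
¬VietaEq-descent {k} {x} {y} (suc s) 11≤k x≤y x+y≤1+s 0<x 0<y e
  with divides q x²+4≡qy ← VietaEq⇒∣ {k} {x} {y} e | q <? y
... | no q≮y = ¬VietaEq-minimal {k} {x} {y} 11≤k 0<x x≤y y²≤x²+4 e
  where
  y²≤x²+4 : y * y ≤ x * x + 4
  y²≤x²+4 = subst (y * y ≤_) (trans (*-comm y q) (sym x²+4≡qy)) (*-monoʳ-≤ y (≮⇒≥ q≮y))
... | yes q<y = [ (λ x≤q → ¬VietaEq-descent s 11≤k x≤q x+q≤s 0<x 0<q e′)
                , (λ q≤x → ¬VietaEq-descent s 11≤k q≤x q+x≤s 0<q 0<x (VietaEq-sym {k} {x} {q} e′))
                ]′ (≤-total x q)
  where
  instance
    _ : NonZero y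
    _ = >-nonZero 0<y
  e′ : VietaEq k x q
  e′ = VietaEq-jump {k} {x} {y} {q} e x²+4≡qy
  x+q≤s : x + q ≤ s
  x+q≤s = ≤-pred (≤-trans (+-monoʳ-< x q<y) x+y≤1+s)
  q+x≤s : q + x ≤ s
  q+x≤s = subst (_≤ s) (+-comm x q) x+q≤s
  0<q : 0 < q
  0<q = n≢0⇒n>0 λ { refl → m+1+n≢0 (x * x) x²+4≡qy }

¬VietaEq : 11 ≤ k → 0 < x → 0 < y → ¬ VietaEq k x y
¬VietaEq {k} {x} {y} 11≤k 0<x 0<y with ≤-total x y
... | inj₁ x≤y = ¬VietaEq-descent _ 11≤k x≤y ≤-refl 0<x 0<y
... | inj₂ y≤x = ¬VietaEq-descent _ 11≤k y≤x ≤-refl 0<y 0<x ∘′ VietaEq-sym {k} {x} {y}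

odd⇒≡1+2* : ¬ 2 ∣ n → ∃[ j ] n ≡ 1 + 2 * j
odd⇒≡1+2* {n} ¬2∣n with n % 2 in n%2≡ | m%n<n n 2
... | 0 | _ = contradiction (m%n≡0⇒n∣m n 2 n%2≡) ¬2∣n
... | 1 | _ = n / 2 , trans (m≡m%n+[m/n]*n n 2) (cong₂ _+_ n%2≡ (*-comm (n / 2) 2))
... | 2+ _ | s<s (s<s ())

n*n+1≡2*m⇒odd : ∀ {m} → n * n + 1 ≡ 2 * m → ¬ 2 ∣ n
n*n+1≡2*m⇒odd {n} {m} n²+1≡2m 2∣n = >⇒∤ (s<s z<s) 2∣1
  where
  2∣1 : 2 ∣ 1
  2∣1 = ∣m+n∣m⇒∣n (subst (2 ∣_) (sym n²+1≡2m) (m∣m*n m)) (∣m⇒∣m*n n 2∣n)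

half-odd : ∀ j → half (1 + 2 * j) ≡ 1 + 2 * (j + j * j)
half-odd j = begin
  ((1 + 2 * j) * (1 + 2 * j) + 1) / 2 ≡⟨ cong (_/ 2) n²+1≡ ⟩
  (1 + 2 * (j + j * j)) * 2 / 2       ≡⟨ m*n/n≡m (1 + 2 * (j + j * j)) 2 ⟩
  1 + 2 * (j + j * j)                 ∎
  where
  open ≡-Reasoning
  n²+1≡ : (1 + 2 * j) * (1 + 2 * j) + 1 ≡ (1 + 2 * (j + j * j)) * 2
  n²+1≡ = solve (j ∷ [])

odd⇒n*n+1≡2*half : ¬ 2 ∣ n → n * n + 1 ≡ 2 * half n
odd⇒n*n+1≡2*half n-odd with j , refl ← odd⇒≡1+2* n-odd = begin
  (1 + 2 * j) * (1 + 2 * j) + 1 ≡⟨ solve (j ∷ []) ⟩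
  2 * (1 + 2 * (j + j * j))     ≡⟨ cong (2 *_) (half-odd j) ⟨
  2 * half (1 + 2 * j)          ∎
  where open ≡-Reasoning

odd⇒half-odd : ¬ 2 ∣ n → ¬ 2 ∣ half n
odd⇒half-odd n-odd with j , refl ← odd⇒≡1+2* n-odd =
  subst (λ h → ¬ 2 ∣ h) (sym (half-odd j)) ¬2∣1+2*
  where
  ¬2∣1+2* : ¬ 2 ∣ 1 + 2 * (j + j * j)
  ¬2∣1+2* (divides q eq) = even≢odd q (j + j * j) (trans (*-comm 2 q) (sym eq))

gcd≡1-of-divisors : n * n + 1 ≡ 2 * M → ¬ 2 ∣ M → d₁ ∣ M → d₁ + d₂ ≡ 2 * n → gcd d₁ d₂ ≡ 1
gcd≡1-of-divisors {n} {M} {d₁} {d₂} n²+1≡2M M-odd d₁∣M sum =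
  fromInj₁ (λ g≡2 → contradiction (subst (_∣ M) g≡2 g∣M) M-odd) (irreducible[2] g∣2)
  where
  g∣M : gcd d₁ d₂ ∣ M
  g∣M = ∣-trans (gcd[m,n]∣m d₁ d₂) d₁∣M
  g∣2n : gcd d₁ d₂ ∣ 2 * n
  g∣2n = subst (gcd d₁ d₂ ∣_) sum (∣m∣n⇒∣m+n (gcd[m,n]∣m d₁ d₂) (gcd[m,n]∣n d₁ d₂))
  4M≡2n*n+2 : 4 * M ≡ 2 * n * n + 2
  4M≡2n*n+2 = begin
    4 * M           ≡⟨ solve (M ∷ []) ⟩
    2 * (2 * M)     ≡⟨ cong (2 *_) n²+1≡2M ⟨
    2 * (n * n + 1) ≡⟨ solve (n ∷ []) ⟩
    2 * n * n + 2   ∎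
    where open ≡-Reasoning
  g∣2 : gcd d₁ d₂ ∣ 2
  g∣2 = ∣m+n∣m⇒∣n (subst (gcd d₁ d₂ ∣_) 4M≡2n*n+2 (∣n⇒∣m*n 4 g∣M)) (∣m⇒∣m*n n g∣2n)

gcd≡1⇒*∣ : gcd d₁ d₂ ≡ 1 → d₁ ∣ M → d₂ ∣ M → d₁ * d₂ ∣ M
gcd≡1⇒*∣ {d₁} {d₂} g≡1 d₁∣M d₂∣M = subst (_∣ _) lcm≡d₁d₂ (lcm-least d₁∣M d₂∣M)
  where
  lcm≡d₁d₂ : lcm d₁ d₂ ≡ d₁ * d₂
  lcm≡d₁d₂ = begin
    lcm d₁ d₂             ≡⟨ *-identityˡ (lcm d₁ d₂) ⟨
    1 * lcm d₁ d₂         ≡⟨ cong (_* lcm d₁ d₂) g≡1 ⟨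
    gcd d₁ d₂ * lcm d₁ d₂ ≡⟨ gcd*lcm d₁ d₂ ⟩
    d₁ * d₂               ∎
    where open ≡-Reasoning

-- Writing M = r d₁ d₂, the pair (d₁, d₂) solves x² + y² + 4 = (8r − 2) x y.
*∣⇒≡ : 0 < d₁ → 0 < d₂ → d₁ * d₂ ∣ M → d₁ + d₂ ≡ 2 * n → n * n + 1 ≡ 2 * M → d₁ * d₂ ≡ M
*∣⇒≡ {d₁} {d₂} {M} {n} 0<d₁ 0<d₂ (divides r M≡r*d₁d₂) sum n²+1≡2M = cofactor r M≡r*d₁d₂
  where
  open ≡-Reasoning
  square+4≡8M : (d₁ + d₂) * (d₁ + d₂) + 4 ≡ 8 * M
  square+4≡8M = begin
    (d₁ + d₂) * (d₁ + d₂) + 4 ≡⟨ cong (λ s → s * s + 4) sum ⟩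
    2 * n * (2 * n) + 4       ≡⟨ solve (n ∷ []) ⟩
    4 * (n * n + 1)           ≡⟨ cong (4 *_) n²+1≡2M ⟩
    4 * (2 * M)               ≡⟨ solve (M ∷ []) ⟩
    8 * M                     ∎
  cofactor : ∀ r → M ≡ r * (d₁ * d₂) → d₁ * d₂ ≡ M
  cofactor 0 refl = contradiction square+4≡8M (m+1+n≢0 _)
  cofactor 1 refl = sym (*-identityˡ (d₁ * d₂))
  cofactor (2+ r) refl = contradiction vieta (¬VietaEq (m≤m+n 11 (3 + 8 * r)) 0<d₁ 0<d₂)
    where
    vieta : VietaEq (14 + 8 * r) d₁ d₂
    vieta = +-cancelʳ-≡ (2 * (d₁ * d₂)) _ _ (begin
      d₁ * d₁ + d₂ * d₂ + 4 + 2 * (d₁ * d₂)     ≡⟨ solve (d₁ ∷ d₂ ∷ []) ⟩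
      (d₁ + d₂) * (d₁ + d₂) + 4                 ≡⟨ square+4≡8M ⟩
      8 * ((2 + r) * (d₁ * d₂))                 ≡⟨ solve (r ∷ d₁ ∷ d₂ ∷ []) ⟩
      (14 + 8 * r) * d₁ * d₂ + 2 * (d₁ * d₂)    ∎)

good-of-factorisation : 0 < d₁ → 0 < d₂ → d₁ + d₂ ≡ 2 * n → n * n + 1 ≡ 2 * (d₁ * d₂) → Good n
good-of-factorisation {d₁} {d₂} {n} 0<d₁ 0<d₂ sum n²+1≡2d₁d₂ =
  (0<n , n-odd) , d₁ , d₂ , 0<d₁ , 0<d₂ ,
  subst (d₁ ∣_) (sym half≡d₁d₂) (m∣m*n d₂) , subst (d₂ ∣_) (sym half≡d₁d₂) (n∣m*n d₁) , sum
  where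
  n-odd : ¬ 2 ∣ n
  n-odd = n*n+1≡2*m⇒odd {n} {d₁ * d₂} n²+1≡2d₁d₂
  0<n : 0 < n
  0<n = n≢0⇒n>0 λ { refl → n-odd (2 ∣0) }
  half≡d₁d₂ : half n ≡ d₁ * d₂
  half≡d₁d₂ = trans (cong (_/ 2) (trans n²+1≡2d₁d₂ (*-comm 2 (d₁ * d₂)))) (m*n/n≡m (d₁ * d₂) 2)

-- x (x + 4v) = 4v² + 1 says that n = x + 2v solves the Pell equation n² − 8v² = 1;
-- the step is multiplication by the fundamental unit 3 + √8.
pell-unbounded : ∀ m → ∃[ x ] ∃[ v ] m ≤ v × 0 < x × x * (x + 4 * v) ≡ 4 * (v * v) + 1
pell-unbounded zero = 1 , 0 , z≤n , z<s , refl
pell-unbounded (suc m) with x , v , m≤v , 0<x , pell ← pell-unbounded m =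
  x + 4 * v , x + 5 * v ,
  +-mono-≤ 0<x (≤-trans m≤v (m≤n*m v 5)) , ≤-trans 0<x (m≤m+n x (4 * v)) ,
  +-cancelʳ-≡ _ _ _ (begin
    (x + 4 * v) * (x + 4 * v + 4 * (x + 5 * v)) + (4 * (v * v) + 1) ≡⟨ solve (x ∷ v ∷ []) ⟩
    4 * ((x + 5 * v) * (x + 5 * v)) + 1 + x * (x + 4 * v)           ≡⟨ cong (4 * ((x + 5 * v) * (x + 5 * v)) + 1 +_) pell ⟩
    4 * ((x + 5 * v) * (x + 5 * v)) + 1 + (4 * (v * v) + 1)         ∎)
  where open ≡-Reasoning

infinitely-many-good : (m : ℕ) → ∃[ n ] (m ≤ n × Good n)
infinitely-many-good m with x , v , m≤v , 0<x , pell ← pell-unbounded m =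
  x + 2 * v , ≤-trans m≤v (≤-trans (m≤n*m v 2) (m≤n+m (2 * v) x)) ,
  good-of-factorisation 0<x (≤-trans 0<x (m≤m+n x (4 * v))) sum n²+1≡2d₁d₂
  where
  open ≡-Reasoning
  sum : x + (x + 4 * v) ≡ 2 * (x + 2 * v)
  sum = solve (x ∷ v ∷ [])
  n²+1≡2d₁d₂ : (x + 2 * v) * (x + 2 * v) + 1 ≡ 2 * (x * (x + 4 * v))
  n²+1≡2d₁d₂ = begin
    (x + 2 * v) * (x + 2 * v) + 1       ≡⟨ solve (x ∷ v ∷ []) ⟩
    x * (x + 4 * v) + (4 * (v * v) + 1) ≡⟨ cong (x * (x + 4 * v) +_) pell ⟨
    x * (x + 4 * v) + x * (x + 4 * v)   ≡⟨ solve (x ∷ v ∷ []) ⟩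
    2 * (x * (x + 4 * v))               ∎

good-pair⇒coprime-factorisation : (n d₁ d₂ : ℕ) → PosOdd n → GoodPair n d₁ d₂ →
                                  gcd d₁ d₂ ≡ 1 × d₁ * d₂ ≡ half n
good-pair⇒coprime-factorisation n d₁ d₂ (_ , n-odd) (0<d₁ , 0<d₂ , d₁∣M , d₂∣M , sum) =
  g≡1 , *∣⇒≡ {n = n} 0<d₁ 0<d₂ (gcd≡1⇒*∣ g≡1 d₁∣M d₂∣M) sum n²+1≡2M
  where
  n²+1≡2M : n * n + 1 ≡ 2 * half n
  n²+1≡2M = odd⇒n*n+1≡2*half n-odd
  g≡1 : gcd d₁ d₂ ≡ 1
  g≡1 = gcd≡1-of-divisors {n} n²+1≡2M (odd⇒half-odd n-odd) d₁∣M sum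

proposition1 : ((m : ℕ) → ∃[ n ] (m ≤ n × Good n))
    × ((n d₁ d₂ : ℕ) → PosOdd n → GoodPair n d₁ d₂ → gcd d₁ d₂ ≡ 1 × d₁ * d₂ ≡ half n)
proposition1 = infinitely-many-good , good-pair⇒coprime-factorisation
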